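{- Let $G$ be a graph in which every vertex belongs to a triangle, let $F$ be a minimum feedback edge set of $G$, and let $D$ be the set of endpoints of edges of $F$. Then for every $w \in V(G) \setminus D$ and every edge $uv \in F$, the vertex $w$ is satisfied by $uv$ if and only if $\{w,u,v\}$ induces a triangle in $G$.
   Context: All graphs are finite, simple and undirected. A feedback edge set of $G$ is $F \subseteq E(G)$ such that $G - F$ is a forest. For $uv \in F$ with $u,v$ in the same connected component of the forest $G-F$, let $P_{u,v}$ denote the unique path between $u$ and $v$ in $G - F$. A vertex $w$ is satisfied by the feedback edge $uv \in F$ if $w$ lies on $P_{u,v}$ and $u, v \in N_G(w)$. -}

module Defs where

open import Data.Nat using (ℕ; zero; suc; _+_; _≤_; _<ᵇ_)
open import Data.Fin using (Fin; toℕ)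
open import Data.Bool using (Bool; true; false; _∧_; not; if_then_else_)
open import Data.List using (List; []; _∷_; length; map)
open import Data.Nat.ListAction using (sum)
open import Data.List.Relation.Unary.Unique.Propositional using (Unique)
open import Data.List.Membership.Propositional using (_∈_)
open import Data.Product using (Σ; _×_; ∃; ∃-syntax)
open import Data.Fin.Base using () 
open import Data.List.Base using ()
open import Relation.Binary.PropositionalEquality using (_≡_)
open import Relation.Nullary using (¬_)
open import Function.Bundles using (_⇔_)

record Graph (n : ℕ) : Set where
  field
    adj   : Fin n → Fin n → Bool
    sym   : ∀ i j → adj i j ≡ adj j i
    irrefl : ∀ i → adj i i ≡ false
open Graph public

EdgeSet : ℕ → Set
EdgeSet n = Fin n → Fin n → Bool

Adj : ∀ {n} → Graph n → Fin n → Fin n → Set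
Adj G i j = adj G i j ≡ true

IsEdgeSubset : ∀ {n} → Graph n → EdgeSet n → Set
IsEdgeSubset G F = (∀ i j → F i j ≡ F j i) × (∀ i j → F i j ≡ true → Adj G i j)

Minus : ∀ {n} → Graph n → EdgeSet n → Fin n → Fin n → Set
Minus G F i j = Adj G i j × F i j ≡ false

data Walk {n : ℕ} (R : Fin n → Fin n → Set) : Fin n → Fin n → List (Fin n) → Set where
  here : ∀ {x} → Walk R x x (x ∷ [])
  step : ∀ {x y z xs} → R x y → Walk R y z xs → Walk R x z (x ∷ xs)

IsPath : ∀ {n} → (Fin n → Fin n → Set) → Fin n → Fin n → List (Fin n) → Set
IsPath R x y xs = Walk R x y xs × Unique xs

HasCycle : ∀ {n} → (Fin n → Fin n → Set) → Set
HasCycle R = ∃[ x ] ∃[ y ] ∃[ xs ] (IsPath R x y xs × 3 ≤ length xs × R y x)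

IsFeedbackEdgeSet : ∀ {n} → Graph n → EdgeSet n → Set
IsFeedbackEdgeSet G F = IsEdgeSubset G F × ¬ HasCycle (Minus G F)

allV : (n : ℕ) → List (Fin n)
allV n = Data.List.Base.tabulate {n = n} (λ i → i)

size : ∀ {n} → EdgeSet n → ℕ
size {n} F = sum (map (λ i → sum (map (λ j →
  if (toℕ i <ᵇ toℕ j) ∧ F i j then 1 else 0) (allV n))) (allV n))

IsMinFES : ∀ {n} → Graph n → EdgeSet n → Set
IsMinFES G F = IsFeedbackEdgeSet G F ×
  (∀ F' → IsFeedbackEdgeSet G F' → size F ≤ size F')

EveryVertexInTriangle : ∀ {n} → Graph n → Set
EveryVertexInTriangle G = ∀ x → ∃[ y ] ∃[ z ] (Adj G x y × Adj G y z × Adj G x z)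

InD : ∀ {n} → EdgeSet n → Fin n → Set
InD F w = ∃[ x ] (F w x ≡ true)

-- w is satisfied by the feedback edge uv: w lies on the (unique, since G - F
-- is a forest) path between u and v in G - F, and u, v ∈ N_G(w).
Satisfied : ∀ {n} → Graph n → EdgeSet n → Fin n → Fin n → Fin n → Set
Satisfied G F w u v =
  (∃[ xs ] (IsPath (Minus G F) u v xs × w ∈ xs)) × Adj G w u × Adj G w v

Triangle : ∀ {n} → Graph n → Fin n → Fin n → Fin n → Set
Triangle G w u v = Adj G w u × Adj G w v × Adj G u v

module Submission where

open import Defs
open import Data.Nat using (ℕ)
open import Data.Fin using (Fin)
open import Data.Bool using (true; false)
open import Data.Bool.Properties using (¬-not; not-¬)
open import Data.List using ([]; _∷_)
open import Data.List.Relation.Unary.All using ([]; _∷_)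
open import Data.List.Relation.Unary.AllPairs using ([]; _∷_)
open import Data.List.Relation.Unary.Any using (here; there)
open import Data.Product using (_,_)
open import Relation.Binary.PropositionalEquality using (_≡_; _≢_; refl; trans)
open import Relation.Nullary using (¬_)
open import Function.Bundles using (_⇔_; mk⇔)

-- The forward direction only uses F ⊆ E(G); the backward one only that w ∉ D,
-- so that u w v is a path of G - F through w.

Adj-sym : ∀ {n} (G : Graph n) {i j : Fin n} → Adj G i j → Adj G j i
Adj-sym G {i} {j} aij = trans (Graph.sym G j i) aij

Adj⇒≢ : ∀ {n} (G : Graph n) {i j : Fin n} → Adj G i j → i ≢ j
Adj⇒≢ G {i} aij refl = not-¬ aij (Graph.irrefl G i)

¬InD⇒notIn : ∀ {n} (F : EdgeSet n) {w : Fin n} → ¬ InD F w → ∀ x → F w x ≡ false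
¬InD⇒notIn F w∉D x = ¬-not (λ fwx → w∉D (x , fwx))

Minus-from-¬InD : ∀ {n} (G : Graph n) (F : EdgeSet n) {w x : Fin n} →
                  ¬ InD F w → Adj G w x → Minus G F w x
Minus-from-¬InD G F {x = x} w∉D awx = awx , ¬InD⇒notIn F w∉D x

Minus-sym : ∀ {n} (G : Graph n) (F : EdgeSet n) → (∀ i j → F i j ≡ F j i) →
            ∀ {i j} → Minus G F i j → Minus G F j i
Minus-sym G F F-sym {i} {j} (aij , fij) = Adj-sym G aij , trans (F-sym j i) fij

path₃ : ∀ {n} {R : Fin n → Fin n → Set} {x y z : Fin n} →
        R x y → R y z → x ≢ y → x ≢ z → y ≢ z → IsPath R x z (x ∷ y ∷ z ∷ [])
path₃ rxy ryz x≢y x≢z y≢z =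
  step rxy (step ryz here) , (x≢y ∷ x≢z ∷ []) ∷ (y≢z ∷ []) ∷ [] ∷ []

lemma4 : ∀ {n : ℕ} (G : Graph n) → EveryVertexInTriangle G →
         (F : EdgeSet n) → IsMinFES G F →
         (w : Fin n) → ¬ InD F w →
         (u v : Fin n) → F u v ≡ true →
         Satisfied G F w u v ⇔ Triangle G w u v
lemma4 G _ F (((F-sym , F⊆E) , _) , _) w w∉D u v fuv = mk⇔ satisfied⇒triangle triangle⇒satisfied
  where
  satisfied⇒triangle : Satisfied G F w u v → Triangle G w u v
  satisfied⇒triangle (_ , awu , awv) = awu , awv , F⊆E u v fuv

  triangle⇒satisfied : Triangle G w u v → Satisfied G F w u v
  triangle⇒satisfied (awu , awv , auv) = (_ , u-w-v , there (here refl)) , awu , awv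
    where
    u-w-v : IsPath (Minus G F) u v (u ∷ w ∷ v ∷ [])
    u-w-v = path₃ (Minus-sym G F F-sym (Minus-from-¬InD G F w∉D awu))
                  (Minus-from-¬InD G F w∉D awv)
                  (Adj⇒≢ G (Adj-sym G awu)) (Adj⇒≢ G auv) (Adj⇒≢ G awv)
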